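{- Let $T$ be a tree of order $n$ with $C(T)>1$. Let $uv$ be an edge of $T$ such that, if $G_1,G_2$ are the two components of $T-uv$, then $p(G_2)-p(G_1)=C(T)$. If (1) $C\left(G_2,\left\lceil \frac{C(T)}{2}\right\rceil\right)=\left\lfloor\frac{n}{2}\right\rfloor-\left\lceil\frac{C(T)}{2}\right\rceil$, or (2) $C\left(G_2,\left\lfloor \frac{C(T)}{2}\right\rfloor\right)=\left\lceil\frac{n}{2}\right\rceil-\left\lfloor\frac{C(T)}{2}\right\rfloor$, then $\sigma^{ - }(T)=2$.
   Context: For a connected simple graph $G$ of order $p$, a parity labelling is a bijection $f:V(G)\to\{1,\ldots,p\}$; an edge $uv$ is negative if $f(u),f(v)$ have opposite parity. The rna number $\sigma^{ - }(G)$ is the minimum over all such $f$ of the number of negative edges. $p(H)$ denotes the order of a graph $H$. For a tree $T$, $C(T)$ is the minimum of $\big||S_1|-|S_2|\big|$ over all partitions of $V(T)$ into two nonempty sets $S_1,S_2$ whose induced subgraphs $\langle S_1\rangle,\langle S_2\rangle$ are both connected; and for an integer $a$, $C(T,a)$ is the minimum of $\big||S_1|-|S_2|\big|$ over all such partitions with the additional requirement $|S_1|\leq a$. -}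

module Defs where

open import Data.Nat using (ℕ; zero; suc; _+_; _≤_; _<_; _%_; _≡ᵇ_; _<ᵇ_; ∣_-_∣)
open import Data.Bool using (Bool; true; false; _∧_; not; if_then_else_)
open import Data.Fin using (Fin; toℕ; _≟_)
open import Data.Fin.Subset using (Subset; _∈_; _∉_; _⊆_; _─_; ∣_∣; Nonempty; ⊤)
open import Data.List using (List; []; _∷_; _++_; [_]; length; concatMap; map; filterᵇ)
open import Data.List.Relation.Unary.Unique.Propositional using (Unique)
open import Data.Product using (Σ; _×_; _,_; ∃)
open import Data.Empty using (⊥)
open import Relation.Nullary using (¬_; does)
open import Relation.Binary.PropositionalEquality using (_≡_)
open import Function.Bundles using (_⤖_; Bijection)
open import Data.Fin.Base using () renaming (_≤_ to _≤F_)
open import Data.List.Base using () renaming (allFin to allFinL)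

record Graph (n : ℕ) : Set where
  field
    adj   : Fin n → Fin n → Bool
    sym   : ∀ x y → adj x y ≡ adj y x
    irrefl : ∀ x → adj x x ≡ false
open Graph public

-- Walk in G from x to y all of whose vertices lie in S
-- (i.e. a walk in the induced subgraph ⟨S⟩).
data Walk {n : ℕ} (G : Graph n) (S : Subset n) : Fin n → Fin n → Set where
  here : ∀ {x} → x ∈ S → Walk G S x x
  step : ∀ {x y z} → x ∈ S → adj G x y ≡ true → Walk G S y z → Walk G S x z

InducedConnected : ∀ {n} → Graph n → Subset n → Set
InducedConnected G S = ∀ x y → x ∈ S → y ∈ S → Walk G S x y

Connected : ∀ {n} → Graph n → Set
Connected G = InducedConnected G ⊤

data Chain {n : ℕ} (G : Graph n) : List (Fin n) → Set where
  one  : ∀ x → Chain G (x ∷ [])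
  cons : ∀ x y rest → adj G x y ≡ true → Chain G (y ∷ rest) → Chain G (x ∷ y ∷ rest)

HasCycle : ∀ {n} → Graph n → Set
HasCycle {n} G = Σ (Fin n) λ x → Σ (List (Fin n)) λ ys →
  2 ≤ length ys × Unique (x ∷ ys) × Chain G (x ∷ ys ++ [ x ])

IsTree : ∀ {n} → Graph n → Set
IsTree {n} G = 1 ≤ n × Connected G × ¬ HasCycle G

deleteEdge : ∀ {n} → Graph n → Fin n → Fin n → Graph n
deleteEdge {n} G u v = record
  { adj = λ x y → adj G x y ∧ not (isUV x y)
  ; sym = symP
  ; irrefl = irr }
  where
  open import Data.Bool.Properties using (∧-comm)
  open import Relation.Binary.PropositionalEquality using (refl; cong₂; trans)
  open import Data.Bool using (_∨_)
  eqb : Fin n → Fin n → Bool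
  eqb a b = does (a ≟ b)
  isUV : Fin n → Fin n → Bool
  isUV x y = (eqb x u ∧ eqb y v) ∨ (eqb x v ∧ eqb y u)
  open import Data.Bool.Properties using (∨-comm)
  isUV-sym : ∀ x y → isUV x y ≡ isUV y x
  isUV-sym x y = trans (∨-comm (eqb x u ∧ eqb y v) (eqb x v ∧ eqb y u))
    (cong₂ _∨_ (∧-comm (eqb x v) (eqb y u)) (∧-comm (eqb x u) (eqb y v)))
  symP : ∀ x y → adj G x y ∧ not (isUV x y) ≡ adj G y x ∧ not (isUV y x)
  symP x y = cong₂ (λ a b → a ∧ not b) (Graph.sym G x y) (isUV-sym x y)
  irr : ∀ x → adj G x x ∧ not (isUV x x) ≡ false
  irr x rewrite Graph.irrefl G x = refl

IsComponent : ∀ {n} → Graph n → Subset n → Fin n → Set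
IsComponent H A x =
  x ∈ A × InducedConnected H A × (∀ y z → y ∈ A → adj H y z ≡ true → z ∈ A)

ConnPartition : ∀ {n} → Graph n → Subset n → Subset n → Set
ConnPartition H S S₁ =
  S₁ ⊆ S × Nonempty S₁ × Nonempty (S ─ S₁)
  × InducedConnected H S₁ × InducedConnected H (S ─ S₁)

balance : ∀ {n} → Subset n → Subset n → ℕ
balance S S₁ = ∣ ∣ S₁ ∣ - ∣ S ─ S₁ ∣ ∣

-- IsCa H S a c : c = C(⟨S⟩, a), the minimum of ||S₁|-|S₂|| over connected
-- partitions (S₁,S₂) of S with |S₁| ≤ a.
IsCa : ∀ {n} → Graph n → Subset n → ℕ → ℕ → Set
IsCa {n} H S a c =
  (Σ (Subset n) λ S₁ → ConnPartition H S S₁ × ∣ S₁ ∣ ≤ a × balance S S₁ ≡ c)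
  × (∀ S₁ → ConnPartition H S S₁ → ∣ S₁ ∣ ≤ a → c ≤ balance S S₁)

IsC : ∀ {n} → Graph n → Subset n → ℕ → Set
IsC {n} H S c =
  (Σ (Subset n) λ S₁ → ConnPartition H S S₁ × balance S S₁ ≡ c)
  × (∀ S₁ → ConnPartition H S S₁ → c ≤ balance S S₁)

allPairs : ∀ n → List (Fin n × Fin n)
allPairs n = concatMap (λ i → map (λ j → (i , j)) (allFinL n)) (allFinL n)

-- label of x under f : Fin n → Fin n is toℕ (f x) + 1 ∈ {1,…,n}
label : ∀ {n} → (Fin n → Fin n) → Fin n → ℕ
label f x = suc (toℕ (f x))

-- number of negative edges: edges {x,y} (counted once, via x < y) whose
-- labels have opposite parity
negEdges : ∀ {n} → Graph n → (Fin n → Fin n) → ℕ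
negEdges {n} G f = length (filterᵇ isNeg (allPairs n))
  where
  isNeg : Fin n × Fin n → Bool
  isNeg (x , y) = (toℕ x <ᵇ toℕ y) ∧ adj G x y
                  ∧ not ((label f x % 2) ≡ᵇ (label f y % 2))

-- σ⁻(G) = k : minimum over parity labellings (bijections) of the number of
-- negative edges equals k
RnaIs : ∀ {n} → Graph n → ℕ → Set
RnaIs {n} G k =
  (Σ (Fin n ⤖ Fin n) λ f → negEdges G (Bijection.to f) ≡ k)
  × (∀ (f : Fin n ⤖ Fin n) → k ≤ negEdges G (Bijection.to f))

-- If a labelling had at most one negative edge, then the vertices with odd labels,
-- and likewise those with even labels, would induce connected subgraphs: a walk between two
-- vertices of one class can leave and re-enter it only through the single crossing edge, so the
-- excursion can be cut out. This connected partition has sizes ⌈n/2⌉ and ⌊n/2⌋, whence C(T) ≤ 1.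
--
-- Hypothesis (1), resp. (2), gives a connected partition A, B of G₂ with |A| ≤ k
-- and ||A| − |B|| = h − k, where (k, h) = (⌈c/2⌉, ⌊n/2⌋), resp. (⌊c/2⌋, ⌈n/2⌉). As n = 2p(G₁) + c,
-- also |A| + |B| = p(G₂) = h + k, and solving gives |B| = h.
-- Give the ⌈n/2⌉ odd labels to the complement of B, resp. to B (two Boolean colourings of the
-- vertices with equally many true values differ by a permutation). The negative edges are then
-- the edges leaving B: the edge uv and the edges between A and B, of which a tree has at most
-- one, since two of them together with paths inside A and B would form a cycle.
module Submission where

open import Data.Bool using (Bool; true; false; not; T; _∧_; _∨_)
open import Data.Bool.Properties using (not-injective; T?; T-∧; T-≡; ∧-conicalˡ)
open import Data.Empty using (⊥-elim)
open import Data.Fin using (Fin; zero; suc; toℕ; _≟_)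
open import Data.Fin.Permutation as Permutation using (Permutation′; _⟨$⟩ʳ_; _∘ₚ_; lift₀; transpose)
open import Data.Fin.Properties using (toℕ-injective)
open import Data.Fin.Subset using (Subset; _∈_; _∉_; _⊆_; ⊤; _─_; ∣_∣; ∁; Nonempty)
open import Data.Fin.Subset.Properties
  using (_∈?_; ∈⊤; drop-∷-⊆; ⊆-antisym; ∣∁p∣≡n∸∣p∣; ∣p∣≤n; x∉p⇒x∈∁p; x∈∁p⇒x∉p; p─q⊆p; x∈p∧x∉q⇒x∈p─q)
open import Data.List
  using (List; []; _∷_; _++_; [_]; length; filterᵇ; map; concatMap; cartesianProduct; allFin)
open import Data.List.Membership.Propositional using () renaming (_∈_ to _∈ˡ_)
import Data.List.Membership.DecPropositional as DecMembership
open import Data.List.Membership.Propositional.Properties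
  using (∈-cartesianProduct⁺; ∈-allFin; ∈-filter⁺; ∈-filter⁻)
open import Data.List.Properties using (++-assoc)
open import Data.List.Relation.Unary.All using ([]; _∷_)
open import Data.List.Relation.Unary.All.Properties using (¬Any⇒All¬)
open import Data.List.Relation.Unary.AllPairs using ([]; _∷_)
open import Data.List.Relation.Unary.Any using (here; there)
open import Data.List.Relation.Unary.Unique.Propositional using (Unique)
import Data.List.Relation.Unary.Unique.Propositional.Properties as Unique
open import Data.Nat
  using (ℕ; zero; suc; _+_; _∸_; _%_; _≡ᵇ_; _<ᵇ_; ∣_-_∣; ⌊_/2⌋; ⌈_/2⌉; _<_; _≤_; z≤n; s≤s)
open import Data.Nat.Properties
  using ( +-0-commutativeMonoid; +-suc; +-assoc; +-comm; +-cancelˡ-≡; +-cancelʳ-≡; +-monoˡ-≤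
        ; suc-injective; ≤-total; ≤-antisym; ≤-trans; ≤-pred; _≤?_; <⇒≱; ≰⇒>; <-cmp; <-asym; <ᵇ⇒<; <⇒<ᵇ
        ; <⇒≢; <-trans; m<m+n; m+[n∸m]≡n; m+n∸m≡n; m+n∸n≡m; m≤n+m; m≤n⇒∣m-n∣≡n∸m; m≤n⇒∣n-m∣≡n∸m
        ; ⌊n/2⌋+⌈n/2⌉≡n; ⌊n/2⌋≤⌈n/2⌉; ⌊n/2⌋-mono; ⌈n/2⌉-mono)
open import Data.Product using (Σ; ∃; _,_; _×_; proj₁; proj₂)
open import Data.Product.Properties using (,-injectiveˡ; ,-injectiveʳ; ≡-dec)
open import Data.Sum as Sum using (_⊎_; inj₁; inj₂)
open import Data.Vec using ([]; _∷_; tabulate; lookup; here; there)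
open import Data.Vec.Properties using (lookup∘tabulate; tabulate∘lookup; []=⇒lookup; lookup⇒[]=)
open import Function using (_∘_; id)
open import Function.Bundles using (Equivalence; _⤖_; Bijection)
open import Function.Properties.Bijection using (⤖⇒↔)
open import Function.Properties.Inverse using (↔⇒⤖)
open import Relation.Binary.Construct.Closure.Symmetric using (SymClosure; fwd; bwd; symmetric)
open import Relation.Binary.Definitions using (tri<; tri≈; tri>)
open import Relation.Binary.PropositionalEquality
  using (_≡_; _≢_; refl; sym; trans; cong; cong₂; subst; module ≡-Reasoning)
open import Relation.Nullary using (¬_; Dec; does; yes; no; contradiction)

open import Defs hiding (sym)

import Algebra.Properties.CommutativeMonoid.Sum +-0-commutativeMonoid as ℕ-Sum

-- Counting Boolean colourings of Fin n

indicator : Bool → ℕ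
indicator true  = 1
indicator false = 0

count : ∀ {n} → (Fin n → Bool) → ℕ
count χ = ℕ-Sum.sum (indicator ∘ χ)

count-permute : ∀ {n} (χ : Fin n → Bool) (π : Permutation′ n) → count (λ i → χ (π ⟨$⟩ʳ i)) ≡ count χ
count-permute χ π = sym (ℕ-Sum.sum-permute (indicator ∘ χ) π)

count+count-not≡n : ∀ {n} (χ : Fin n → Bool) → count χ + count (not ∘ χ) ≡ n
count+count-not≡n {zero}  χ = refl
count+count-not≡n {suc n} χ with χ zero
... | true  = cong suc (count+count-not≡n (χ ∘ suc))
... | false = trans (+-suc _ _) (cong suc (count+count-not≡n (χ ∘ suc)))

count-not : ∀ {n} (χ : Fin n → Bool) → count (not ∘ χ) ≡ n ∸ count χ
count-not χ = trans (sym (m+n∸m≡n (count χ) _)) (cong (_∸ count χ) (count+count-not≡n χ))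

true⇒0<count : ∀ {n} (χ : Fin n → Bool) i → χ i ≡ true → 0 < count χ
true⇒0<count {suc n} χ i χi rewrite ℕ-Sum.sum-remove {i = i} (indicator ∘ χ) | χi = s≤s z≤n

0<count⇒∃true : ∀ {n} (χ : Fin n → Bool) → 0 < count χ → ∃ λ i → χ i ≡ true
0<count⇒∃true {suc n} χ pos with χ zero in χ0
... | true  = zero , χ0
... | false = let (i , χi) = 0<count⇒∃true (χ ∘ suc) pos in suc i , χi

same-count⇒∃match : ∀ {n} (χ ψ : Fin n → Bool) → count χ ≡ count ψ → ∀ i → ∃ λ j → ψ j ≡ χ i
same-count⇒∃match χ ψ eq i with χ i in χi
... | true  = 0<count⇒∃true ψ (subst (0 <_) eq (true⇒0<count χ i χi))
... | false = let (j , ψj) = 0<count⇒∃true (not ∘ ψ)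
                               (subst (0 <_) eq-not (true⇒0<count (not ∘ χ) i (cong not χi)))
              in j , not-injective ψj
  where
  eq-not : count (not ∘ χ) ≡ count (not ∘ ψ)
  eq-not = trans (count-not χ) (trans (cong (_ ∸_) eq) (sym (count-not ψ)))

-- Swap into position 0 a position j with ψ j ≡ χ 0, then recurse on the tails.
same-count⇒permutation : ∀ {n} (χ ψ : Fin n → Bool) → count χ ≡ count ψ →
                         Σ (Permutation′ n) λ π → ∀ i → ψ (π ⟨$⟩ʳ i) ≡ χ i
same-count⇒permutation {zero}  χ ψ eq = Permutation.id , λ ()
same-count⇒permutation {suc n} χ ψ eq with same-count⇒∃match χ ψ eq zero
... | j , ψj≡χ0 = lift₀ (proj₁ tail) ∘ₚ τ , matches
  where
  open ≡-Reasoning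
  τ : Permutation′ (suc n)
  τ = transpose zero j
  ψ′ : Fin (suc n) → Bool
  ψ′ i = ψ (τ ⟨$⟩ʳ i)
  tail : Σ (Permutation′ n) λ π → ∀ i → ψ′ (suc (π ⟨$⟩ʳ i)) ≡ χ (suc i)
  tail = same-count⇒permutation (χ ∘ suc) (ψ′ ∘ suc) (+-cancelˡ-≡ (indicator (χ zero)) _ _ (begin
    count χ                               ≡⟨ eq ⟩
    count ψ                               ≡⟨ count-permute ψ τ ⟨
    indicator (ψ j) + count (ψ′ ∘ suc)    ≡⟨ cong (λ b → indicator b + count (ψ′ ∘ suc)) ψj≡χ0 ⟩
    indicator (χ zero) + count (ψ′ ∘ suc) ∎))
  matches : ∀ i → ψ ((lift₀ (proj₁ tail) ∘ₚ τ) ⟨$⟩ʳ i) ≡ χ i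
  matches zero    = ψj≡χ0
  matches (suc i) = proj₂ tail i

-- Parity of labels

isOdd : ℕ → Bool
isOdd zero          = false
isOdd (suc zero)    = true
isOdd (suc (suc m)) = isOdd m

%2≡indicator∘isOdd : ∀ m → m % 2 ≡ indicator (isOdd m)
%2≡indicator∘isOdd zero          = refl
%2≡indicator∘isOdd (suc zero)    = refl
%2≡indicator∘isOdd (suc (suc m)) = %2≡indicator∘isOdd m

count-isOdd∘suc : ∀ n → count {n} (λ k → isOdd (suc (toℕ k))) ≡ ⌈ n /2⌉
count-isOdd     : ∀ n → count {n} (λ k → isOdd (toℕ k)) ≡ ⌊ n /2⌋
count-isOdd∘suc zero    = refl
count-isOdd∘suc (suc n) = cong suc (count-isOdd n)
count-isOdd zero    = refl
count-isOdd (suc n) = count-isOdd∘suc n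

differ⇒negative : ∀ a b → isOdd a ≢ isOdd b → T (not (a % 2 ≡ᵇ b % 2))
differ⇒negative a b differ rewrite %2≡indicator∘isOdd a | %2≡indicator∘isOdd b
  with isOdd a | isOdd b
... | false | false = differ refl
... | false | true  = _
... | true  | false = _
... | true  | true  = differ refl

negative⇒differ : ∀ a b → T (not (a % 2 ≡ᵇ b % 2)) → isOdd a ≢ isOdd b
negative⇒differ a b rewrite %2≡indicator∘isOdd a | %2≡indicator∘isOdd b
  with isOdd a | isOdd b
... | false | false = λ ()
... | false | true  = λ _ ()
... | true  | false = λ _ ()
... | true  | true  = λ ()

oddLabel : ∀ {n} → (Fin n → Fin n) → Fin n → Bool
oddLabel f x = isOdd (label f x)

labelling-with-odd-set : ∀ {n} (χ : Fin n → Bool) → count χ ≡ ⌈ n /2⌉ →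
                         Σ (Fin n ⤖ Fin n) λ f → ∀ x → oddLabel (Bijection.to f) x ≡ χ x
labelling-with-odd-set {n} χ count≡ with same-count⇒permutation χ (λ k → isOdd (suc (toℕ k)))
                                           (trans count≡ (sym (count-isOdd∘suc n)))
... | π , matches = ↔⇒⤖ π , matches

-- Subsets as Boolean vectors

module _ {n : ℕ} {χ : Fin n → Bool} where

  ∈-tabulate⁺ : ∀ {x} → χ x ≡ true → x ∈ tabulate χ
  ∈-tabulate⁺ {x} χx = lookup⇒[]= x (tabulate χ) (trans (lookup∘tabulate χ x) χx)

  ∈-tabulate⁻ : ∀ {x} → x ∈ tabulate χ → χ x ≡ true
  ∈-tabulate⁻ {x} x∈ = trans (sym (lookup∘tabulate χ x)) ([]=⇒lookup x∈)

  tabulate-separates : ∀ {x y} → x ∈ tabulate χ → y ∉ tabulate χ → χ x ≢ χ y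
  tabulate-separates x∈ y∉ χx≡χy = y∉ (∈-tabulate⁺ (trans (sym χx≡χy) (∈-tabulate⁻ x∈)))

∣tabulate∣≡count : ∀ {n} (χ : Fin n → Bool) → ∣ tabulate χ ∣ ≡ count χ
∣tabulate∣≡count {zero}  χ = refl
∣tabulate∣≡count {suc n} χ with χ zero
... | true  = cong suc (∣tabulate∣≡count (χ ∘ suc))
... | false = ∣tabulate∣≡count (χ ∘ suc)

∣p∣≡count : ∀ {n} (p : Subset n) → ∣ p ∣ ≡ count (lookup p)
∣p∣≡count p = trans (cong ∣_∣ (sym (tabulate∘lookup p))) (∣tabulate∣≡count (lookup p))

⊤─tabulate : ∀ {n} (χ : Fin n → Bool) → ⊤ ─ tabulate χ ≡ tabulate (not ∘ χ)
⊤─tabulate {zero}  χ = refl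
⊤─tabulate {suc n} χ with χ zero
... | true  = cong (false ∷_) (⊤─tabulate (χ ∘ suc))
... | false = cong (true ∷_) (⊤─tabulate (χ ∘ suc))

x∈p─q⇒x∉q : ∀ {n} {p q : Subset n} {x} → x ∈ p ─ q → x ∉ q
x∈p─q⇒x∉q {p = _ ∷ _} {q = true  ∷ _} {zero} ()
x∈p─q⇒x∉q {p = _ ∷ _} {q = false ∷ _} {zero} here ()
x∈p─q⇒x∉q {p = _ ∷ _} {q = _ ∷ _} (there x∈) (there x∈q) = x∈p─q⇒x∉q x∈ x∈q

∣p∣≡∣q∣+∣p─q∣ : ∀ {n} {p q : Subset n} → q ⊆ p → ∣ p ∣ ≡ ∣ q ∣ + ∣ p ─ q ∣
∣p∣≡∣q∣+∣p─q∣ {p = []}         {[]}         _   = refl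
∣p∣≡∣q∣+∣p─q∣ {p = true  ∷ _} {true  ∷ _} q⊆p = cong suc (∣p∣≡∣q∣+∣p─q∣ (drop-∷-⊆ q⊆p))
∣p∣≡∣q∣+∣p─q∣ {p = true  ∷ _} {false ∷ q} q⊆p =
  trans (cong suc (∣p∣≡∣q∣+∣p─q∣ (drop-∷-⊆ q⊆p))) (sym (+-suc ∣ q ∣ _))
∣p∣≡∣q∣+∣p─q∣ {p = false ∷ _} {false ∷ _} q⊆p = ∣p∣≡∣q∣+∣p─q∣ (drop-∷-⊆ q⊆p)
∣p∣≡∣q∣+∣p─q∣ {p = false ∷ _} {true  ∷ _} q⊆p = contradiction (q⊆p here) λ ()

x∈p⇒0<∣p∣ : ∀ {n} {p : Subset n} {x} → x ∈ p → 0 < ∣ p ∣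
x∈p⇒0<∣p∣ {p = p} {x} x∈p = subst (0 <_) (sym (∣p∣≡count p)) (true⇒0<count (lookup p) x ([]=⇒lookup x∈p))

lookup-separates : ∀ {n} {p : Subset n} {x y} → lookup p x ≢ lookup p y → x ∈ p × y ∉ p ⊎ y ∈ p × x ∉ p
lookup-separates {p = p} {x} {y} differ with lookup p x in px | lookup p y in py
... | true  | true  = ⊥-elim (differ refl)
... | false | false = ⊥-elim (differ refl)
... | true  | false = inj₁ (lookup⇒[]= x p px , λ y∈p → contradiction (trans (sym ([]=⇒lookup y∈p)) py) λ ())
... | false | true  = inj₂ (lookup⇒[]= y p py , λ x∈p → contradiction (trans (sym ([]=⇒lookup x∈p)) px) λ ())

-- Negative edges

concatMap-pairs≡cartesianProduct : ∀ {A B : Set} (xs : List A) (ys : List B) →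
  concatMap (λ x → map (λ y → (x , y)) ys) xs ≡ cartesianProduct xs ys
concatMap-pairs≡cartesianProduct []       ys = refl
concatMap-pairs≡cartesianProduct (x ∷ xs) ys =
  cong (map (λ y → (x , y)) ys ++_) (concatMap-pairs≡cartesianProduct xs ys)

∈-allPairs : ∀ {n} (x y : Fin n) → (x , y) ∈ˡ allPairs n
∈-allPairs {n} x y = subst ((x , y) ∈ˡ_) (sym (concatMap-pairs≡cartesianProduct (allFin n) (allFin n)))
  (∈-cartesianProduct⁺ (∈-allFin x) (∈-allFin y))

allPairs-unique : ∀ n → Unique (allPairs n)
allPairs-unique n = subst Unique (sym (concatMap-pairs≡cartesianProduct (allFin n) (allFin n)))
  (Unique.cartesianProduct⁺ (Unique.allFin⁺ n) (Unique.allFin⁺ n))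

module _ {n : ℕ} (G : Graph n) (f : Fin n → Fin n) where

  -- The test filtered in Defs.negEdges, so that negEdges G f is definitionally length negativePairs.
  isNegative : Fin n × Fin n → Bool
  isNegative (x , y) = (toℕ x <ᵇ toℕ y) ∧ adj G x y ∧ not ((label f x % 2) ≡ᵇ (label f y % 2))

  negativePairs : List (Fin n × Fin n)
  negativePairs = filterᵇ isNegative (allPairs n)

  negativePairs-unique : Unique negativePairs
  negativePairs-unique = Unique.filter⁺ (T? ∘ isNegative) (allPairs-unique n)

  ∈-negativePairs⁻ : ∀ {x y} → (x , y) ∈ˡ negativePairs →
                     toℕ x < toℕ y × adj G x y ≡ true × oddLabel f x ≢ oddLabel f y
  ∈-negativePairs⁻ {x} {y} mem
    with Equivalence.to T-∧ (proj₂ (∈-filter⁻ (T? ∘ isNegative) {xs = allPairs n} mem))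
  ... | x<y , rest with Equivalence.to T-∧ rest
  ...   | xy , negative =
    <ᵇ⇒< (toℕ x) (toℕ y) x<y , Equivalence.to T-≡ xy , negative⇒differ (label f x) (label f y) negative

  negative∈negativePairs : ∀ {x y} → adj G x y ≡ true → oddLabel f x ≢ oddLabel f y →
                           (x , y) ∈ˡ negativePairs ⊎ (y , x) ∈ˡ negativePairs
  negative∈negativePairs {x} {y} xy differ with <-cmp (toℕ x) (toℕ y)
  ... | tri< x<y _ _ = inj₁ (∈-filter⁺ (T? ∘ isNegative) (∈-allPairs x y)
          (Equivalence.from T-∧ (<⇒<ᵇ x<y , Equivalence.from T-∧
            (Equivalence.from T-≡ xy , differ⇒negative (label f x) (label f y) differ))))
  ... | tri≈ _ x≡y _ = ⊥-elim (differ (cong (oddLabel f) (toℕ-injective x≡y)))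
  ... | tri> _ _ y<x = inj₂ (∈-filter⁺ (T? ∘ isNegative) (∈-allPairs y x)
          (Equivalence.from T-∧ (<⇒<ᵇ y<x , Equivalence.from T-∧
            (Equivalence.from T-≡ (trans (Graph.sym G y x) xy) ,
             differ⇒negative (label f y) (label f x) (differ ∘ sym)))))

AtMostOnePair : ∀ {n} → (Fin n → Fin n → Set) → Set
AtMostOnePair R = ∀ {x y x′ y′} → R x y → R x′ y′ → (x , y) ≡ (x′ , y′)

AscendingPair : ∀ {n} → (Fin n → Fin n → Set) → Fin n × Fin n → Set
AscendingPair R (x , y) = toℕ x < toℕ y × SymClosure R x y

AscendingPair-unique : ∀ {n} {R : Fin n → Fin n → Set} → AtMostOnePair R →
                       ∀ {p q} → AscendingPair R p → AscendingPair R q → p ≡ q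
AscendingPair-unique unique (_   , fwd r) (_     , fwd r′) = unique r r′
AscendingPair-unique unique (_   , bwd r) (_     , bwd r′) with unique r r′
... | refl = refl
AscendingPair-unique unique (x<y , fwd r) (x′<y′ , bwd r′) with unique r r′
... | refl = ⊥-elim (<-asym x<y x′<y′)
AscendingPair-unique unique (x<y , bwd r) (x′<y′ , fwd r′) with unique r r′
... | refl = ⊥-elim (<-asym x<y x′<y′)

Unique-length≤2 : ∀ {A : Set} {P Q : A → Set} →
                  (∀ {p q} → P p → P q → p ≡ q) → (∀ {p q} → Q p → Q q → p ≡ q) →
                  ∀ {xs} → Unique xs → (∀ {p} → p ∈ˡ xs → P p ⊎ Q p) → length xs ≤ 2
Unique-length≤2 P-unique Q-unique {[]}         _ _ = z≤n
Unique-length≤2 P-unique Q-unique {_ ∷ []}     _ _ = s≤s z≤n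
Unique-length≤2 P-unique Q-unique {_ ∷ _ ∷ []} _ _ = s≤s (s≤s z≤n)
Unique-length≤2 P-unique Q-unique {p ∷ q ∷ r ∷ _} ((p≢q ∷ p≢r ∷ _) ∷ (q≢r ∷ _) ∷ _) classes
  with classes (here refl) | classes (there (here refl)) | classes (there (there (here refl)))
... | inj₁ Pp | inj₁ Pq | _       = ⊥-elim (p≢q (P-unique Pp Pq))
... | inj₂ Qp | inj₂ Qq | _       = ⊥-elim (p≢q (Q-unique Qp Qq))
... | inj₁ Pp | inj₂ _  | inj₁ Pr = ⊥-elim (p≢r (P-unique Pp Pr))
... | inj₁ _  | inj₂ Qq | inj₂ Qr = ⊥-elim (q≢r (Q-unique Qq Qr))
... | inj₂ Qp | inj₁ _  | inj₂ Qr = ⊥-elim (p≢r (Q-unique Qp Qr))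
... | inj₂ _  | inj₁ Pq | inj₁ Pr = ⊥-elim (q≢r (P-unique Pq Pr))

negEdges≤2 : ∀ {n} (G : Graph n) (f : Fin n → Fin n) {R₁ R₂ : Fin n → Fin n → Set} →
             AtMostOnePair R₁ → AtMostOnePair R₂ →
             (∀ {x y} → adj G x y ≡ true → oddLabel f x ≢ oddLabel f y →
                        SymClosure R₁ x y ⊎ SymClosure R₂ x y) →
             negEdges G f ≤ 2
negEdges≤2 G f unique₁ unique₂ classify =
  Unique-length≤2 (AscendingPair-unique unique₁) (AscendingPair-unique unique₂)
                  (negativePairs-unique G f) classes
  where
  classes : ∀ {p} → p ∈ˡ negativePairs G f → AscendingPair _ p ⊎ AscendingPair _ p
  classes mem with ∈-negativePairs⁻ G f mem
  ... | x<y , xy , differ = Sum.map (x<y ,_) (x<y ,_) (classify xy differ)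

length≤1⇒≡ : ∀ {A : Set} {xs : List A} → length xs ≤ 1 → ∀ {p q} → p ∈ˡ xs → q ∈ˡ xs → p ≡ q
length≤1⇒≡ {xs = _ ∷ []}    _        (here refl) (here refl) = refl
length≤1⇒≡ {xs = _ ∷ _ ∷ _} (s≤s ())

-- Walks

module _ {n : ℕ} {G : Graph n} where

  walk-map : ∀ {G′ : Graph n} {S : Subset n} → (∀ {x y} → adj G x y ≡ true → adj G′ x y ≡ true) →
             ∀ {x y} → Walk G S x y → Walk G′ S x y
  walk-map sub (here x∈S)         = here x∈S
  walk-map sub (step x∈S xy rest) = step x∈S (sub xy) (walk-map sub rest)

  walk-preserves : ∀ {S : Subset n} (P : Fin n → Set) → (∀ {y z} → P y → adj G y z ≡ true → P z) →
                   ∀ {x y} → Walk G S x y → P x → P y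
  walk-preserves P closed (here _)         Px = Px
  walk-preserves P closed (step _ xy rest) Px = walk-preserves P closed rest (closed Px xy)

UniqueExit : ∀ {n} → Graph n → Subset n → Set
UniqueExit G S = ∀ {x y x′ y′} → x ∈ S → y ∉ S → adj G x y ≡ true →
                 x′ ∈ S → y′ ∉ S → adj G x′ y′ ≡ true → x ≡ x′

module _ {n : ℕ} {G : Graph n} {S : Subset n} (exit : UniqueExit G S) where

  -- A walk that starts outside S enters S for the last time along an exit edge, whose end
  -- in S is the unique exit vertex.
  reroute : ∀ {z y} → Walk G ⊤ z y → y ∈ S →
            (z ∈ S → Walk G S z y) ×
            (z ∉ S → ∀ {x w} → x ∈ S → w ∉ S → adj G x w ≡ true → Walk G S x y)
  reroute (here _) y∈S = (λ _ → here y∈S) , (λ y∉S → ⊥-elim (y∉S y∈S))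
  reroute {z} (step {y = w} _ zw rest) y∈S with reroute rest y∈S | w ∈? S
  ... | from-w , _        | yes w∈S =
        (λ z∈S → step z∈S zw (from-w w∈S)) ,
        (λ z∉S x∈S w′∉S xw′ → subst (λ x → Walk G S x _)
           (exit w∈S z∉S (trans (Graph.sym G w z) zw) x∈S w′∉S xw′) (from-w w∈S))
  ... | _      , via-exit | no w∉S =
        (λ z∈S → via-exit w∉S z∈S w∉S zw) , (λ _ → via-exit w∉S)

  uniqueExit⇒connected : Connected G → InducedConnected G S
  uniqueExit⇒connected conn x y x∈S y∈S = proj₁ (reroute (conn x y ∈⊤ ∈⊤) y∈S) x∈S

data Route {n : ℕ} (G : Graph n) (S : Subset n) : Fin n → Fin n → List (Fin n) → Set where
  end  : ∀ {x} → x ∈ S → Route G S x x []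
  step : ∀ {x y z ys} → x ∈ S → adj G x y ≡ true → Route G S y z ys → Route G S x z (y ∷ ys)

module _ {n : ℕ} {G : Graph n} {S : Subset n} where

  route-⊆ : ∀ {x y ys z} → Route G S x y ys → z ∈ˡ x ∷ ys → z ∈ S
  route-⊆ (end x∈S)      (here refl) = x∈S
  route-⊆ (step x∈S _ _) (here refl) = x∈S
  route-⊆ (step _ _ p)   (there z∈)  = route-⊆ p z∈

  route-chain : ∀ {x y ys z zs} → Route G S x y ys → adj G y z ≡ true →
                Chain G (z ∷ zs) → Chain G (x ∷ ys ++ z ∷ zs)
  route-chain (end _)       yz chain = cons _ _ _ yz chain
  route-chain (step _ xy p) yz chain = cons _ _ _ xy (route-chain p yz chain)

  route-suffix : ∀ {w y ys x} → Route G S w y ys → Unique (w ∷ ys) → x ∈ˡ w ∷ ys →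
                 Σ (List (Fin n)) λ zs → Route G S x y zs × Unique (x ∷ zs)
  route-suffix p            u       (here refl) = _ , p , u
  route-suffix (step _ _ p) (_ ∷ u) (there x∈)  = route-suffix p u x∈

  walk⇒simple-route : ∀ {x y} → Walk G S x y →
                      Σ (List (Fin n)) λ ys → Route G S x y ys × Unique (x ∷ ys)
  walk⇒simple-route (here x∈S) = [] , end x∈S , [] ∷ []
  walk⇒simple-route {x} (step x∈S xy rest) with walk⇒simple-route rest
  ... | ys , p , u with DecMembership._∈?_ _≟_ x (_ ∷ ys)
  ...   | yes x∈ = route-suffix p u x∈
  ...   | no  x∉ = _ ∷ ys , step x∈S xy p , ¬Any⇒All¬ _ x∉ ∷ u

module _ {n : ℕ} {G : Graph n} {A B : Subset n} (disjoint : ∀ {z} → z ∈ A → z ∉ B) where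

  private
    two-routes-long : ∀ {a a′ b b′ qs rs} → (a , b) ≢ (a′ , b′) →
                      Route G A a a′ qs → Route G B b′ b rs → 2 ≤ length (qs ++ b′ ∷ rs)
    two-routes-long ab≢a′b′ (end _)                 (end _)      = ⊥-elim (ab≢a′b′ refl)
    two-routes-long ab≢a′b′ (end _)                 (step _ _ _) = s≤s (s≤s z≤n)
    two-routes-long ab≢a′b′ (step _ _ (end _))      _            = s≤s (s≤s z≤n)
    two-routes-long ab≢a′b′ (step _ _ (step _ _ _)) _            = s≤s (s≤s z≤n)

  -- The cycle runs a ⇝ a′ inside A, crosses to b′, runs b′ ⇝ b inside B and returns to a.
  two-crossings⇒cycle : ∀ {a a′ b b′} → Walk G A a a′ → Walk G B b′ b →
                        adj G a′ b′ ≡ true → adj G b a ≡ true → (a , b) ≢ (a′ , b′) → HasCycle G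
  two-crossings⇒cycle {a} {b′ = b′} wA wB a′b′ ba ab≢a′b′
    with walk⇒simple-route wA | walk⇒simple-route wB
  ... | qs , pA , uA | rs , pB , uB =
    a , qs ++ b′ ∷ rs , two-routes-long ab≢a′b′ pA pB ,
    Unique.++⁺ uA uB (λ (v∈A , v∈B) → disjoint (route-⊆ pA v∈A) (route-⊆ pB v∈B)) ,
    subst (λ vs → Chain G (a ∷ vs)) (sym (++-assoc qs (b′ ∷ rs) [ a ]))
      (route-chain pA a′b′ (route-chain pB ba (one a)))

-- Lower bound

distinct⇒2≤n : ∀ {n} {x y : Fin n} → x ≢ y → 2 ≤ n
distinct⇒2≤n {suc zero}    {zero} {zero} x≢y = ⊥-elim (x≢y refl)
distinct⇒2≤n {suc (suc n)} _                 = s≤s (s≤s z≤n)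

∣⌈n/2⌉-⌊n/2⌋∣≤1 : ∀ n → ∣ ⌈ n /2⌉ - ⌊ n /2⌋ ∣ ≤ 1
∣⌈n/2⌉-⌊n/2⌋∣≤1 zero          = z≤n
∣⌈n/2⌉-⌊n/2⌋∣≤1 (suc zero)    = s≤s z≤n
∣⌈n/2⌉-⌊n/2⌋∣≤1 (suc (suc n)) = ∣⌈n/2⌉-⌊n/2⌋∣≤1 n

negEdges≤1⇒uniqueExit : ∀ {n} (G : Graph n) (g : Fin n → Fin n) {S : Subset n} → negEdges G g ≤ 1 →
                        (∀ {x y} → x ∈ S → y ∉ S → oddLabel g x ≢ oddLabel g y) → UniqueExit G S
negEdges≤1⇒uniqueExit G g {S} ≤1 crossing x∈S y∉S xy x′∈S y′∉S x′y′
  with negative∈negativePairs G g xy (crossing x∈S y∉S)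
     | negative∈negativePairs G g x′y′ (crossing x′∈S y′∉S)
... | inj₁ m | inj₁ m′ = ,-injectiveˡ (length≤1⇒≡ ≤1 m m′)
... | inj₂ m | inj₂ m′ = ,-injectiveʳ (length≤1⇒≡ ≤1 m m′)
... | inj₁ m | inj₂ m′ = ⊥-elim (y′∉S (subst (_∈ S) (,-injectiveˡ (length≤1⇒≡ ≤1 m m′)) x∈S))
... | inj₂ m | inj₁ m′ = ⊥-elim (y∉S (subst (_∈ S) (sym (,-injectiveˡ (length≤1⇒≡ ≤1 m m′))) x′∈S))

module _ {n : ℕ} (f : Fin n ⤖ Fin n) where

  private
    g : Fin n → Fin n
    g = Bijection.to f

  oddLabelled : Subset n
  oddLabelled = tabulate (oddLabel g)

  evenLabelled : Subset n
  evenLabelled = tabulate (not ∘ oddLabel g)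

  count-oddLabel : count (oddLabel g) ≡ ⌈ n /2⌉
  count-oddLabel = trans (count-permute (λ k → isOdd (suc (toℕ k))) (⤖⇒↔ f)) (count-isOdd∘suc n)

  ∣oddLabelled∣ : ∣ oddLabelled ∣ ≡ ⌈ n /2⌉
  ∣oddLabelled∣ = trans (∣tabulate∣≡count (oddLabel g)) count-oddLabel

  ∣evenLabelled∣ : ∣ evenLabelled ∣ ≡ ⌊ n /2⌋
  ∣evenLabelled∣ = begin
    ∣ evenLabelled ∣             ≡⟨ ∣tabulate∣≡count (not ∘ oddLabel g) ⟩
    count (not ∘ oddLabel g)     ≡⟨ count-not (oddLabel g) ⟩
    n ∸ count (oddLabel g)       ≡⟨ cong (n ∸_) count-oddLabel ⟩
    n ∸ ⌈ n /2⌉                  ≡⟨ cong (_∸ ⌈ n /2⌉) (⌊n/2⌋+⌈n/2⌉≡n n) ⟨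
    ⌊ n /2⌋ + ⌈ n /2⌉ ∸ ⌈ n /2⌉   ≡⟨ m+n∸n≡m ⌊ n /2⌋ ⌈ n /2⌉ ⟩
    ⌊ n /2⌋                      ∎
    where open ≡-Reasoning

  parity-balance≤1 : balance ⊤ oddLabelled ≤ 1
  parity-balance≤1 = subst (_≤ 1)
    (sym (cong₂ ∣_-_∣ ∣oddLabelled∣ (trans (cong ∣_∣ (⊤─tabulate (oddLabel g))) ∣evenLabelled∣)))
    (∣⌈n/2⌉-⌊n/2⌋∣≤1 n)

  parity-partition : (G : Graph n) → Connected G → 2 ≤ n → negEdges G g ≤ 1 →
                     ConnPartition G ⊤ oddLabelled
  parity-partition G conn 2≤n ≤1 rewrite ⊤─tabulate (oddLabel g) =
      (λ _ → ∈⊤)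
    , nonempty (subst (0 <_) (sym ∣oddLabelled∣) (⌈n/2⌉-mono 2≤n))
    , nonempty (subst (0 <_) (sym ∣evenLabelled∣) (⌊n/2⌋-mono 2≤n))
    , uniqueExit⇒connected (negEdges≤1⇒uniqueExit G g ≤1 tabulate-separates) conn
    , uniqueExit⇒connected
        (negEdges≤1⇒uniqueExit G g ≤1 (λ x∈ y∉ → tabulate-separates x∈ y∉ ∘ cong not)) conn
    where
    nonempty : ∀ {χ : Fin n → Bool} → 0 < ∣ tabulate χ ∣ → Nonempty (tabulate χ)
    nonempty {χ} pos = let (x , χx) = 0<count⇒∃true χ (subst (0 <_) (∣tabulate∣≡count χ) pos)
                       in x , ∈-tabulate⁺ χx

2≤negEdges : ∀ {n} (G : Graph n) → Connected G → ∀ {c} → IsC G ⊤ c → 1 < c →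
             (f : Fin n ⤖ Fin n) → 2 ≤ negEdges G (Bijection.to f)
2≤negEdges G conn ((S₁ , (_ , (x , x∈S₁) , (y , y∈⊤─S₁) , _) , _) , minimal) 1<c f
  with 2 ≤? negEdges G (Bijection.to f)
... | yes 2≤ = 2≤
... | no  2≰ = ⊥-elim (<⇒≱ 1<c (≤-trans (minimal (oddLabelled f) partition) (parity-balance≤1 f)))
  where
  2≤n : 2 ≤ _
  2≤n = distinct⇒2≤n (λ x≡y → x∈p─q⇒x∉q y∈⊤─S₁ (subst (_∈ S₁) x≡y x∈S₁))
  partition : ConnPartition G ⊤ (oddLabelled f)
  partition = parity-partition f G conn 2≤n (≤-pred (≰⇒> 2≰))

-- Deleting an edge of a tree

PairOf : ∀ {n} → Fin n → Fin n → Fin n → Fin n → Set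
PairOf u v x y = x ≡ u × y ≡ v

PairOf-unique : ∀ {n} {u v : Fin n} → AtMostOnePair (PairOf u v)
PairOf-unique (refl , refl) (refl , refl) = refl

Between : ∀ {n} → Graph n → Subset n → Subset n → Fin n → Fin n → Set
Between G A B a b = a ∈ A × b ∈ B × adj G a b ≡ true

between-unique : ∀ {n} {G : Graph n} {A B : Subset n} → ¬ HasCycle G →
                 InducedConnected G A → InducedConnected G B → (∀ {z} → z ∈ A → z ∉ B) →
                 AtMostOnePair (Between G A B)
between-unique {G = G} acyclic connA connB disjoint {a} {b} {a′} {b′}
               (a∈A , b∈B , ab) (a′∈A , b′∈B , a′b′)
  with ≡-dec _≟_ _≟_ (a , b) (a′ , b′)
... | yes ab≡a′b′ = ab≡a′b′
... | no  ab≢a′b′ = ⊥-elim (acyclic (two-crossings⇒cycle disjoint (connA a a′ a∈A a′∈A)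
                      (connB b′ b b′∈B b∈B) a′b′ (trans (Graph.sym G b a) ab) ab≢a′b′))

module _ {n : ℕ} (T : Graph n) (u v : Fin n) where

  deleteEdge-⊆ : ∀ {x y} → adj (deleteEdge T u v) x y ≡ true → adj T x y ≡ true
  deleteEdge-⊆ {x} {y} = ∧-conicalˡ (adj T x y) _

  deleteEdge-⊇ : ∀ {x y} → adj T x y ≡ true →
                 adj (deleteEdge T u v) x y ≡ true ⊎ SymClosure (PairOf u v) x y
  deleteEdge-⊇ {x} {y} xy = kept (x ≟ u) (y ≟ v) (x ≟ v) (y ≟ u)
    where
    kept : (p : Dec (x ≡ u)) (q : Dec (y ≡ v)) (r : Dec (x ≡ v)) (s : Dec (y ≡ u)) →
           adj T x y ∧ not ((does p ∧ does q) ∨ (does r ∧ does s)) ≡ true ⊎ SymClosure (PairOf u v) x y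
    kept (yes x≡u) (yes y≡v) _         _         = inj₂ (fwd (x≡u , y≡v))
    kept _         _         (yes x≡v) (yes y≡u) = inj₂ (bwd (y≡u , x≡v))
    kept (no _)    _         (no _)    _         rewrite xy = inj₁ refl
    kept (no _)    _         (yes _)   (no _)    rewrite xy = inj₁ refl
    kept (yes _)   (no _)    (no _)    _         rewrite xy = inj₁ refl
    kept (yes _)   (no _)    (yes _)   (no _)    rewrite xy = inj₁ refl

Closed : ∀ {n} → Graph n → Subset n → Set
Closed H C = ∀ y z → y ∈ C → adj H y z ≡ true → z ∈ C

connected⊆closed : ∀ {n} {H : Graph n} {C C′ : Subset n} {z} →
                   InducedConnected H C → Closed H C′ → z ∈ C → z ∈ C′ → C ⊆ C′
connected⊆closed conn closed z∈C z∈C′ {y} y∈C =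
  walk-preserves (_∈ _) (λ {a} {b} → closed a b) (conn _ y z∈C y∈C) z∈C′

module SplitAtEdge {n : ℕ} {T : Graph n} (conn : Connected T) (acyclic : ¬ HasCycle T)
                   {u v : Fin n} {G₁ G₂ : Subset n}
                   (comp₁ : IsComponent (deleteEdge T u v) G₁ u)
                   (comp₂ : IsComponent (deleteEdge T u v) G₂ v) where

  components-cover : ∀ x → x ∈ G₁ ⊎ x ∈ G₂
  components-cover x = walk-preserves _ extend (conn u x ∈⊤ ∈⊤) (inj₁ (proj₁ comp₁))
    where
    extend : ∀ {y z} → y ∈ G₁ ⊎ y ∈ G₂ → adj T y z ≡ true → z ∈ G₁ ⊎ z ∈ G₂
    extend y∈ yz with deleteEdge-⊇ T u v yz
    ... | inj₂ (fwd (_ , refl)) = inj₂ (proj₁ comp₂)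
    ... | inj₂ (bwd (refl , _)) = inj₁ (proj₁ comp₁)
    ... | inj₁ yz∈H = Sum.map (λ y∈G₁ → proj₂ (proj₂ comp₁) _ _ y∈G₁ yz∈H)
                              (λ y∈G₂ → proj₂ (proj₂ comp₂) _ _ y∈G₂ yz∈H) y∈

  shared-vertex⇒G₁≡G₂ : ∀ {z} → z ∈ G₁ → z ∈ G₂ → G₁ ≡ G₂
  shared-vertex⇒G₁≡G₂ z∈G₁ z∈G₂ =
    ⊆-antisym (connected⊆closed (proj₁ (proj₂ comp₁)) (proj₂ (proj₂ comp₂)) z∈G₁ z∈G₂)
              (connected⊆closed (proj₁ (proj₂ comp₂)) (proj₂ (proj₂ comp₁)) z∈G₂ z∈G₁)

  distinct-sizes⇒disjoint : ∣ G₁ ∣ ≢ ∣ G₂ ∣ → ∀ {z} → z ∈ G₁ → z ∉ G₂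
  distinct-sizes⇒disjoint ∣G₁∣≢∣G₂∣ z∈G₁ z∈G₂ = ∣G₁∣≢∣G₂∣ (cong ∣_∣ (shared-vertex⇒G₁≡G₂ z∈G₁ z∈G₂))

  ∣G₁∣+∣G₂∣≡n : (∀ {z} → z ∈ G₁ → z ∉ G₂) → ∣ G₁ ∣ + ∣ G₂ ∣ ≡ n
  ∣G₁∣+∣G₂∣≡n disjoint = begin
    ∣ G₁ ∣ + ∣ G₂ ∣       ≡⟨ cong (λ p → ∣ G₁ ∣ + ∣ p ∣) G₂≡∁G₁ ⟩
    ∣ G₁ ∣ + ∣ ∁ G₁ ∣     ≡⟨ cong (∣ G₁ ∣ +_) (∣∁p∣≡n∸∣p∣ G₁) ⟩
    ∣ G₁ ∣ + (n ∸ ∣ G₁ ∣) ≡⟨ m+[n∸m]≡n (∣p∣≤n G₁) ⟩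
    n                     ∎
    where
    open ≡-Reasoning
    G₂≡∁G₁ : G₂ ≡ ∁ G₁
    G₂≡∁G₁ = ⊆-antisym (λ z∈G₂ → x∉p⇒x∈∁p (λ z∈G₁ → disjoint z∈G₁ z∈G₂))
                       (λ {z} z∈∁G₁ → Sum.[ (λ z∈G₁ → contradiction z∈G₁ (x∈∁p⇒x∉p z∈∁G₁)) , id ]
                                        (components-cover z))

  module _ {A : Subset n} (partition : ConnPartition (deleteEdge T u v) G₂ A) where

    private
      B : Subset n
      B = G₂ ─ A

    ∣A∣+∣B∣≡∣G₂∣ : ∣ A ∣ + ∣ B ∣ ≡ ∣ G₂ ∣
    ∣A∣+∣B∣≡∣G₂∣ = sym (∣p∣≡∣q∣+∣p─q∣ (proj₁ partition))

    leaving-B : ∀ {x y} → x ∈ B → y ∉ B → adj T x y ≡ true →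
                SymClosure (PairOf u v) x y ⊎ SymClosure (Between T A B) x y
    leaving-B {x} {y} x∈B y∉B xy with deleteEdge-⊇ T u v xy
    ... | inj₂ xy≡uv = inj₁ xy≡uv
    ... | inj₁ xy∈H  = inj₂ (bwd (y∈A , x∈B , trans (Graph.sym T y x) xy))
      where
      y∈G₂ : y ∈ G₂
      y∈G₂ = proj₂ (proj₂ comp₂) x y (p─q⊆p G₂ A x∈B) xy∈H
      y∈A : y ∈ A
      y∈A with y ∈? A
      ... | yes y∈A = y∈A
      ... | no  y∉A = contradiction (x∈p∧x∉q⇒x∈p─q y∈G₂ y∉A) y∉B

    cut-by-B⇒negEdges≤2 : ∀ (g : Fin n → Fin n) →
      (∀ {x y} → oddLabel g x ≢ oddLabel g y → lookup B x ≢ lookup B y) → negEdges T g ≤ 2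
    cut-by-B⇒negEdges≤2 g cut-by-B =
      negEdges≤2 T g PairOf-unique
        (between-unique acyclic (lift connA) (lift connB) (λ z∈A z∈B → x∈p─q⇒x∉q z∈B z∈A))
        classify
      where
      connA = proj₁ (proj₂ (proj₂ (proj₂ partition)))
      connB = proj₂ (proj₂ (proj₂ (proj₂ partition)))
      lift : ∀ {S} → InducedConnected (deleteEdge T u v) S → InducedConnected T S
      lift conn x y x∈S y∈S = walk-map (deleteEdge-⊆ T u v) (conn x y x∈S y∈S)
      classify : ∀ {x y} → adj T x y ≡ true → oddLabel g x ≢ oddLabel g y →
                 SymClosure (PairOf u v) x y ⊎ SymClosure (Between T A B) x y
      classify {x} {y} xy differ with lookup-separates (cut-by-B differ)
      ... | inj₁ (x∈B , y∉B) = leaving-B x∈B y∉B xy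
      ... | inj₂ (y∈B , x∉B) = Sum.map (symmetric _) (symmetric _)
                                        (leaving-B y∈B x∉B (trans (Graph.sym T y x) xy))

    ∃negEdges≤2 : ∣ B ∣ ≡ ⌈ n /2⌉ ⊎ ∣ B ∣ ≡ ⌊ n /2⌋ →
                  Σ (Fin n ⤖ Fin n) λ f → negEdges T (Bijection.to f) ≤ 2
    ∃negEdges≤2 (inj₁ ∣B∣≡⌈n/2⌉)
      with labelling-with-odd-set (lookup B) (trans (sym (∣p∣≡count B)) ∣B∣≡⌈n/2⌉)
    ... | f , odd≡B = f , cut-by-B⇒negEdges≤2 (Bijection.to f) λ {x} {y} differ same →
                            differ (trans (odd≡B x) (trans same (sym (odd≡B y))))
    ∃negEdges≤2 (inj₂ ∣B∣≡⌊n/2⌋) with labelling-with-odd-set (not ∘ lookup B) count≡⌈n/2⌉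
      where
      open ≡-Reasoning
      count≡⌈n/2⌉ : count (not ∘ lookup B) ≡ ⌈ n /2⌉
      count≡⌈n/2⌉ = begin
        count (not ∘ lookup B)       ≡⟨ count-not (lookup B) ⟩
        n ∸ count (lookup B)         ≡⟨ cong (n ∸_) (trans (sym (∣p∣≡count B)) ∣B∣≡⌊n/2⌋) ⟩
        n ∸ ⌊ n /2⌋                  ≡⟨ cong (_∸ ⌊ n /2⌋) (⌊n/2⌋+⌈n/2⌉≡n n) ⟨
        ⌊ n /2⌋ + ⌈ n /2⌉ ∸ ⌊ n /2⌋   ≡⟨ m+n∸m≡n ⌊ n /2⌋ ⌈ n /2⌉ ⟩
        ⌈ n /2⌉                      ∎
    ... | f , odd≡∁B = f , cut-by-B⇒negEdges≤2 (Bijection.to f) λ {x} {y} differ same →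
                             differ (trans (odd≡∁B x) (trans (cong not same) (sym (odd≡∁B y))))

-- Arithmetic

m+m≡n+n⇒m≡n : ∀ {m n} → m + m ≡ n + n → m ≡ n
m+m≡n+n⇒m≡n {zero}  {zero}  _  = refl
m+m≡n+n⇒m≡n {suc m} {suc n} eq =
  cong suc (m+m≡n+n⇒m≡n (suc-injective (trans (sym (+-suc m m)) (trans (suc-injective eq) (+-suc n n)))))

m+d+m≡n+d+n⇒m≡n : ∀ {m n} d → m + d + m ≡ n + d + n → m ≡ n
m+d+m≡n+d+n⇒m≡n {m} {n} d eq =
  m+m≡n+n⇒m≡n (+-cancelʳ-≡ d _ _ (trans (reorder m) (trans eq (sym (reorder n)))))
  where
  reorder : ∀ x → x + x + d ≡ x + d + x
  reorder x = trans (+-assoc x x d) (trans (cong (x +_) (+-comm x d)) (sym (+-assoc x d x)))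

balanced-piece : ∀ {a b k h} → a ≤ k → k ≤ h → a + b ≡ h + k → ∣ a - b ∣ ≡ h ∸ k → b ≡ h
balanced-piece {a} {b} {k} {h} a≤k k≤h sum diff with ≤-total a b
... | inj₁ a≤b = trans b≡a+d (trans (cong (_+ d) a≡k) (m+[n∸m]≡n k≤h))
  where
  d = h ∸ k
  b≡a+d : b ≡ a + d
  b≡a+d = trans (sym (m+[n∸m]≡n a≤b)) (cong (a +_) (trans (sym (m≤n⇒∣m-n∣≡n∸m a≤b)) diff))
  a≡k : a ≡ k
  a≡k = m+d+m≡n+d+n⇒m≡n d (begin
    a + d + a  ≡⟨ +-comm (a + d) a ⟩
    a + (a + d) ≡⟨ cong (a +_) b≡a+d ⟨
    a + b      ≡⟨ sum ⟩
    h + k      ≡⟨ cong (_+ k) (m+[n∸m]≡n k≤h) ⟨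
    k + d + k  ∎)
    where open ≡-Reasoning
... | inj₂ b≤a = trans b≡k (≤-antisym k≤h (subst (_≤ k) a≡h a≤k))
  where
  d = h ∸ k
  a≡b+d : a ≡ b + d
  a≡b+d = trans (sym (m+[n∸m]≡n b≤a)) (cong (b +_) (trans (sym (m≤n⇒∣n-m∣≡n∸m b≤a)) diff))
  b≡k : b ≡ k
  b≡k = m+d+m≡n+d+n⇒m≡n d (begin
    b + d + b  ≡⟨ cong (_+ b) a≡b+d ⟨
    a + b      ≡⟨ sum ⟩
    h + k      ≡⟨ cong (_+ k) (m+[n∸m]≡n k≤h) ⟨
    k + d + k  ∎)
    where open ≡-Reasoning
  a≡h : a ≡ h
  a≡h = trans a≡b+d (trans (cong (_+ d) b≡k) (m+[n∸m]≡n k≤h))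

⌊m+[m+c]/2⌋ : ∀ m c → ⌊ m + (m + c) /2⌋ ≡ m + ⌊ c /2⌋
⌊m+[m+c]/2⌋ zero    c = refl
⌊m+[m+c]/2⌋ (suc m) c rewrite +-suc m (m + c) = cong suc (⌊m+[m+c]/2⌋ m c)

⌈m+[m+c]/2⌉ : ∀ m c → ⌈ m + (m + c) /2⌉ ≡ m + ⌈ c /2⌉
⌈m+[m+c]/2⌉ zero    c = refl
⌈m+[m+c]/2⌉ (suc m) c rewrite +-suc m (m + c) = cong suc (⌈m+[m+c]/2⌉ m c)

⌈n/2⌉≤1+⌊n/2⌋ : ∀ n → ⌈ n /2⌉ ≤ suc ⌊ n /2⌋
⌈n/2⌉≤1+⌊n/2⌋ zero          = z≤n
⌈n/2⌉≤1+⌊n/2⌋ (suc zero)    = s≤s z≤n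
⌈n/2⌉≤1+⌊n/2⌋ (suc (suc n)) = s≤s (⌈n/2⌉≤1+⌊n/2⌋ n)

module _ {n m c a b : ℕ} (n≡m+[m+c] : n ≡ m + (m + c)) where

  piece≡⌊n/2⌋ : 1 ≤ m → a + b ≡ m + c → a ≤ ⌈ c /2⌉ → ∣ a - b ∣ ≡ ⌊ n /2⌋ ∸ ⌈ c /2⌉ → b ≡ ⌊ n /2⌋
  piece≡⌊n/2⌋ 1≤m sum a≤k diff rewrite n≡m+[m+c] | ⌊m+[m+c]/2⌋ m c =
    balanced-piece a≤k (≤-trans (⌈n/2⌉≤1+⌊n/2⌋ c) (+-monoˡ-≤ ⌊ c /2⌋ 1≤m))
      (trans sum (trans (cong (m +_) (sym (⌊n/2⌋+⌈n/2⌉≡n c))) (sym (+-assoc m ⌊ c /2⌋ ⌈ c /2⌉))))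
      diff

  piece≡⌈n/2⌉ : a + b ≡ m + c → a ≤ ⌊ c /2⌋ → ∣ a - b ∣ ≡ ⌈ n /2⌉ ∸ ⌊ c /2⌋ → b ≡ ⌈ n /2⌉
  piece≡⌈n/2⌉ sum a≤k diff rewrite n≡m+[m+c] | ⌈m+[m+c]/2⌉ m c =
    balanced-piece a≤k (≤-trans (⌊n/2⌋≤⌈n/2⌉ c) (m≤n+m ⌈ c /2⌉ m))
      (trans sum (trans (cong (m +_) (trans (sym (⌊n/2⌋+⌈n/2⌉≡n c)) (+-comm ⌊ c /2⌋ ⌈ c /2⌉)))
                        (sym (+-assoc m ⌈ c /2⌉ ⌊ c /2⌋))))
      diff

mainTheorem11 : (n : ℕ) (T : Graph n) → IsTree T →
    (c : ℕ) → IsC T ⊤ c → 1 < c →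
    (u v : Fin n) → adj T u v ≡ true →
    (G₁ G₂ : Subset n) →
    IsComponent (deleteEdge T u v) G₁ u →
    IsComponent (deleteEdge T u v) G₂ v →
    ∣ G₂ ∣ ≡ ∣ G₁ ∣ + c →
    (IsCa (deleteEdge T u v) G₂ ⌈ c /2⌉ (⌊ n /2⌋ ∸ ⌈ c /2⌉)
      ⊎ IsCa (deleteEdge T u v) G₂ ⌊ c /2⌋ (⌈ n /2⌉ ∸ ⌊ c /2⌋)) →
    RnaIs T 2
mainTheorem11 n T (_ , conn , acyclic) c isC 1<c u v _ G₁ G₂ comp₁ comp₂ ∣G₂∣≡∣G₁∣+c split =
  (proj₁ labelling , ≤-antisym (proj₂ labelling) (2≤negEdges T conn isC 1<c (proj₁ labelling))) ,
  2≤negEdges T conn isC 1<c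
  where
  open SplitAtEdge conn acyclic comp₁ comp₂

  disjoint : ∀ {z} → z ∈ G₁ → z ∉ G₂
  disjoint = distinct-sizes⇒disjoint
    (<⇒≢ (subst (∣ G₁ ∣ <_) (sym ∣G₂∣≡∣G₁∣+c) (m<m+n ∣ G₁ ∣ (<-trans (s≤s z≤n) 1<c))))

  n≡m+[m+c] : n ≡ ∣ G₁ ∣ + (∣ G₁ ∣ + c)
  n≡m+[m+c] = trans (sym (∣G₁∣+∣G₂∣≡n disjoint)) (cong (∣ G₁ ∣ +_) ∣G₂∣≡∣G₁∣+c)

  labelling : Σ (Fin n ⤖ Fin n) λ f → negEdges T (Bijection.to f) ≤ 2
  labelling = Sum.[
    (λ ((_ , part , ∣A∣≤⌈c/2⌉ , balanced) , _) → ∃negEdges≤2 part (inj₂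
       (piece≡⌊n/2⌋ n≡m+[m+c] (x∈p⇒0<∣p∣ (proj₁ comp₁))
          (trans (∣A∣+∣B∣≡∣G₂∣ part) ∣G₂∣≡∣G₁∣+c) ∣A∣≤⌈c/2⌉ balanced))) ,
    (λ ((_ , part , ∣A∣≤⌊c/2⌋ , balanced) , _) → ∃negEdges≤2 part (inj₁
       (piece≡⌈n/2⌉ n≡m+[m+c] (trans (∣A∣+∣B∣≡∣G₂∣ part) ∣G₂∣≡∣G₁∣+c) ∣A∣≤⌊c/2⌋ balanced))) ] split
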